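{- For $n\ge1$ let $K^*_n$ be the digraph with vertex set $N\times N$, $N=\{0,\dots,n-1\}$, with an arc from $(i,j)$ to $(i,j+1)$ for all $i,j\in N$, and an arc from $(i,i)$ to $(j,i)$ for all distinct $i,j\in N$ (sums modulo $n$). Then $\nu(K^*_n)=\tau(K^*_n)=n$ and $\nu^*(K^*_n)=1$. Moreover, $K^*_n$ has maximum in-degree at most two and has no two independent cycles, and $\phi_m(K^*_n)=n+1$.
   Context: Cycles are directed without repeated vertices (loops are cycles); paths are directed without repeated vertices except that first and last vertex may coincide; internal vertices of $v_0\dots v_\ell$ are $v_1,\dots,v_{\ell-1}$; a source is a vertex of in-degree $0$. $\tau$ is the minimum size of a vertex set meeting every cycle; $\nu$ is the maximum number of vertex-disjoint cycles. A packing is a set of vertex-disjoint cycles $C_1,\dots,C_k$; a path is principal if none of its arcs and none of its internal vertices lies on a cycle of the packing; the packing is special if for every $C_i$ and vertex $v$ of $C_i$, the existence of a principal path from some $C_j\ne C_i$ to $v$ implies the existence of a principal path from $C_i$ or from a source to $v$ (possibly a cycle through $v$); $\nu^*$ is the maximum size of a special packing. Two vertex-disjoint cycles are independent if there is no arc from one to the other in either direction. A Boolean network $f:\{0,1\}^m\to\{0,1\}^m$ is monotone if $x\le y\Rightarrow f(x)\le f(y)$; its interaction graph is the digraph on $[m]$ with arc $uv$ iff $f_v$ depends on $x_u$; $\phi_m(G)$ is the maximum number of fixed points of a monotone Boolean network whose interaction graph is isomorphic to $G$. -}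

module Defs where

open import Data.Nat using (ℕ; zero; suc; _≤_; NonZero)
open import Data.Nat.DivMod using (_mod_)
open import Data.Fin using (Fin; toℕ)
open import Data.Product using (Σ; ∃; _×_; _,_)
open import Data.Sum using (_⊎_)
open import Data.List using (List; []; _∷_; [_]; length; _∷ʳ_; filter; map; _++_)
open import Data.List.Membership.Propositional using (_∈_)
open import Data.List.Relation.Unary.Unique.Propositional using (Unique)
open import Data.List.Relation.Unary.All using (All)
open import Data.Bool using (Bool; true; false; not) renaming (_≤_ to _≤ᵇ_; _≟_ to _≟ᵇ_)
open import Data.Vec using (Vec; lookup; _[_]%=_) renaming ([] to []ᵛ; _∷_ to _∷ᵛ_)
open import Data.Vec.Properties using (≡-dec)
open import Data.Vec.Relation.Binary.Pointwise.Inductive using (Pointwise)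
open import Relation.Binary.PropositionalEquality using (_≡_; _≢_)
open import Relation.Nullary using (¬_)
open import Function.Bundles using (_⤖_; _⇔_; Bijection)

module Graph {V : Set} (E : V → V → Set) where

  -- Chain v (w₁ ∷ … ∷ wₗ): arcs v→w₁→…→wₗ
  data Chain : V → List V → Set where
    []  : ∀ {v} → Chain v []
    _∷_ : ∀ {u v vs} → E u v → Chain v vs → Chain u (v ∷ vs)

  lastOf : V → List V → V
  lastOf v [] = v
  lastOf _ (w ∷ ws) = lastOf w ws

  data Consec (a b : V) : List V → Set where
    here  : ∀ {xs} → Consec a b (a ∷ b ∷ xs)
    there : ∀ {x xs} → Consec a b xs → Consec a b (x ∷ xs)

  -- A directed cycle v₀ → v₁ → … → v_{k-1} → v₀ without repeated vertices
  -- (k ≥ 1; k = 1 is a loop).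
  record Cycle : Set where
    field
      start    : V
      rest     : List V
      distinct : Unique (start ∷ rest)
      chain    : Chain start rest
      closing  : E (lastOf start rest) start

  cycVertices : Cycle → List V
  cycVertices C = Cycle.start C ∷ Cycle.rest C

  _∈C_ : V → Cycle → Set
  v ∈C C = v ∈ cycVertices C

  ArcOn : Cycle → V → V → Set
  ArcOn C a b = Consec a b (cycVertices C ∷ʳ Cycle.start C)

  Disjoint : Cycle → Cycle → Set
  Disjoint C D = ∀ v → v ∈C C → ¬ (v ∈C D)

  record Packing (k : ℕ) : Set where
    field
      cyc      : Fin k → Cycle
      disjoint : ∀ i j → i ≢ j → Disjoint (cyc i) (cyc j)

  -- A directed path v₀ v₁ … vₗ with ℓ ≥ 1, internal vertices `mid`,
  -- no repeated vertices except that v₀ = vₗ is allowed.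
  record Path : Set where
    field
      start        : V
      mid          : List V
      end          : V
      chain        : Chain start (mid ∷ʳ end)
      distinctInit : Unique (start ∷ mid)
      distinctTail : Unique (mid ∷ʳ end)

  pathVertices : Path → List V
  pathVertices p = Path.start p ∷ (Path.mid p ∷ʳ Path.end p)

  Principal : ∀ {k} → Packing k → Path → Set
  Principal {k} P p =
    All (λ w → ∀ (i : Fin k) → ¬ (w ∈C Packing.cyc P i)) (Path.mid p)
    × (∀ a b → Consec a b (pathVertices p) → ∀ (i : Fin k) → ¬ ArcOn (Packing.cyc P i) a b)

  Source : V → Set
  Source v = ∀ u → ¬ E u v

  PrincipalFromCycleTo : ∀ {k} → Packing k → Fin k → V → Set
  PrincipalFromCycleTo P j v =
    Σ Path λ p → Principal P p × (Path.start p ∈C Packing.cyc P j) × Path.end p ≡ v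

  PrincipalFromSourceTo : ∀ {k} → Packing k → V → Set
  PrincipalFromSourceTo P v =
    Σ Path λ p → Principal P p × Source (Path.start p) × Path.end p ≡ v

  Special : ∀ {k} → Packing k → Set
  Special {k} P = ∀ (i : Fin k) v → v ∈C Packing.cyc P i →
    (Σ (Fin k) λ j → j ≢ i × PrincipalFromCycleTo P j v) →
    PrincipalFromCycleTo P i v ⊎ PrincipalFromSourceTo P v

  -- a (duplicate-free list representing a) vertex set meeting every cycle
  FeedbackSet : List V → Set
  FeedbackSet S = Unique S × (∀ (C : Cycle) → Σ V λ v → v ∈ S × v ∈C C)

  NuIs : ℕ → Set
  NuIs k = Packing k × (∀ j → Packing j → j ≤ k)

  TauIs : ℕ → Set
  TauIs k = (Σ (List V) λ S → FeedbackSet S × length S ≡ k)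
          × (∀ S → FeedbackSet S → k ≤ length S)

  NuStarIs : ℕ → Set
  NuStarIs k = (Σ (Packing k) Special) × (∀ j (P : Packing j) → Special P → j ≤ k)

  MaxInDegreeAtMost2 : Set
  MaxInDegreeAtMost2 = ∀ v (us : List V) → Unique us → All (λ u → E u v) us → length us ≤ 2

  Independent : Cycle → Cycle → Set
  Independent C D = Disjoint C D × (∀ a b → a ∈C C → b ∈C D → ¬ E a b × ¬ E b a)

  NoTwoIndependentCycles : Set
  NoTwoIndependentCycles = ∀ C D → ¬ Independent C D

BN : ℕ → Set
BN m = Vec Bool m → Vec Bool m

Monotone : ∀ {m} → BN m → Set
Monotone f = ∀ x y → Pointwise _≤ᵇ_ x y → Pointwise _≤ᵇ_ (f x) (f y)

DependsOn : ∀ {m} → BN m → Fin m → Fin m → Set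
DependsOn f u v = ∃ λ x → lookup (f x) v ≢ lookup (f (x [ u ]%= not)) v

allStates : (m : ℕ) → List (Vec Bool m)
allStates zero = [ []ᵛ ]
allStates (suc m) = map (false ∷ᵛ_) (allStates m) ++ map (true ∷ᵛ_) (allStates m)

fixCount : ∀ {m} → BN m → ℕ
fixCount {m} f = length (filter (λ x → ≡-dec _≟ᵇ_ (f x) x) (allStates m))

InteractionGraphIso : ∀ {m} → BN m → {V : Set} → (V → V → Set) → Set
InteractionGraphIso {m} f {V} E =
  Σ (Fin m ⤖ V) λ σ → ∀ u v → DependsOn f u v ⇔ E (Bijection.to σ u) (Bijection.to σ v)

PhiMIs : {V : Set} → (V → V → Set) → ℕ → Set
PhiMIs E k =
  (Σ ℕ λ m → Σ (BN m) λ f → Monotone f × InteractionGraphIso f E × fixCount f ≡ k)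
  × (∀ m (f : BN m) → Monotone f → InteractionGraphIso f E → fixCount f ≤ k)

sucMod : ∀ {n} .{{_ : NonZero n}} → Fin n → Fin n
sucMod {n} j = suc (toℕ j) mod n

data KStarArc (n : ℕ) .{{_ : NonZero n}} : Fin n × Fin n → Fin n × Fin n → Set where
  step : ∀ i j → KStarArc n (i , j) (i , sucMod j)
  jump : ∀ i j → i ≢ j → KStarArc n (i , i) (j , i)

module Submission where

-- In K*_N the in-neighbours of (r , c) are (r , c − 1) and, off the
-- diagonal, (c , c). So a nonempty vertex set in which every vertex has an
-- in-neighbour inside the set contains a diagonal vertex (walk back along a
-- row) and meets every column (walk back along a column, detouring through
-- (c + 1 , c + 1)). Cycles are such sets:
-- hence the N rows give ν = τ = N, and between any two cycles there is an
-- arc (c , c) → (r , c); this arc is a principal path witnessing that no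
-- packing of two cycles is special.
--
-- For fixed points x, y of a monotone network on K*_N, the vertices where
-- x is 0 and y is 1 again form such a set. If x and y were incomparable,
-- one of these sets would contain some (c , c) and the other some (r , c),
-- which monotonicity at (r , c) forbids. So the fixed points form a chain,
-- strictly increasing on the diagonal: at most N + 1 of them. The network
-- with ∧ below the diagonal, ∨ above it and copies on it has the N + 1
-- fixed points "the rows r < k are 1", k = 0, …, N.

open import Defs
open import Data.Bool using (Bool; true; false; not; _∧_; _∨_; b≤b; f≤t)
  renaming (_≤_ to _≤ᵇ_; _≟_ to _≟ᵇ_)
open import Data.Bool.Properties using (≤-minimum; ≤-maximum; not-¬; ¬-not)
open import Data.Empty using (⊥; ⊥-elim)
open import Data.Fin using (Fin; zero; suc; toℕ; fromℕ<)
open import Data.Fin.Properties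
  using (injective⇒≤; any?; toℕ-fromℕ<; toℕ<n; toℕ≤pred[n]; toℕ-injective; <-cmp; *↔×)
  renaming (_≟_ to _≟ᶠ_)
open import Data.Fin.Subset using (Subset; _⊆_; _⊂_; ∣_∣) renaming (_∈_ to _∈ˢ_)
open import Data.Fin.Subset.Properties using (p⊂q⇒∣p∣<∣q∣; ∣p∣≤n)
open import Data.List
  using (List; []; _∷_; length; lookup; map; filter; _∷ʳ_; applyUpTo; allFin; tabulate)
open import Data.List.Properties using (length-tabulate)
open import Data.List.Membership.Propositional using (_∈_)
open import Data.List.Membership.Propositional.Properties
  using (∈-lookup; ∈-map⁺; ∈-map⁻; ∈-++⁺ˡ; ∈-++⁺ʳ; ∈-++⁻; ∈-filter⁺; ∈-filter⁻; ∈-allFin;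
         ∈-applyUpTo⁻; ∈-tabulate⁺)
import Data.List.Membership.Setoid.Properties as SetoidMembership
import Data.List.Relation.Unary.All as All
open import Data.List.Relation.Unary.Any using (here; there)
open import Data.List.Relation.Unary.Unique.Propositional using (Unique; []; _∷_)
import Data.List.Relation.Unary.Unique.Propositional.Properties as Unique
open import Data.Nat using (ℕ; zero; suc; NonZero; _+_; _*_; _∸_; _%_; _≤_; _<_; s≤s; z≤n; _<?_)
open import Data.Nat.Properties
  using (+-identityʳ; +-suc; +-assoc; +-comm; m+[n∸m]≡n; <⇒≤; <⇒≢; <-trans; <-irrefl; <-≤-trans;
         ≤-antisym)
open import Data.Nat.DivMod using (m%n<n; %-distribˡ-+; m%n%n≡m%n; [m+n]%n≡m%n; m<n⇒m%n≡m)
open import Data.Nat.GeneralisedArithmetic using (iterate)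
open import Data.Product using (Σ; ∃; _×_; _,_; proj₁; proj₂)
open import Data.Product.Properties using (≡-dec)
open import Data.Sum using (_⊎_; inj₁; inj₂)
open import Data.Vec using (Vec; _[_]%=_; _[_]≔_; replicate; zipWith)
  renaming ([] to []ᵛ; _∷_ to _∷ᵛ_; lookup to _!_; tabulate to tabulateᵛ)
open import Data.Vec.Properties as Vec
  using (lookup∘updateAt; lookup∘updateAt′; lookup∘update; lookup∘update′; lookup-zipWith;
         lookup∘tabulate; []=⇒lookup; lookup⇒[]=)
  renaming (≡-dec to ≡-decᵛ)
open import Data.Vec.Relation.Binary.Pointwise.Extensional as Ext using (ext; Pointwise-≡⇒≡)
import Data.Vec.Relation.Binary.Pointwise.Inductive as Pointwise
open import Function using (_∘_; Injective; case_of_)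
open import Function.Bundles using (Equivalence; _⤖_; Bijection; mk⇔)
open import Function.Properties.Inverse using (↔⇒⤖)
open import Relation.Binary.Definitions using (DecidableEquality; tri<; tri≈; tri>)
open import Relation.Binary.PropositionalEquality
open import Relation.Nullary using (¬_; yes; no)
open import Relation.Nullary.Decidable using (_×-dec_)

lookup-injective : ∀ {A : Set} {xs : List A} → Unique xs →
                   ∀ {i j} → lookup xs i ≡ lookup xs j → i ≡ j
lookup-injective (_ ∷ _)       {zero}  {zero}  _ = refl
lookup-injective (x∉xs ∷ _)   {zero}  {suc j} e = ⊥-elim (All.lookup x∉xs (∈-lookup j) e)
lookup-injective (x∉xs ∷ _)   {suc i} {zero}  e = ⊥-elim (All.lookup x∉xs (∈-lookup i) (sym e))
lookup-injective (_ ∷ unique) {suc i} {suc j} e = cong suc (lookup-injective unique e)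

Unique⇒length≤ : ∀ {A : Set} {xs : List A} {k} → Unique xs → (h : A → Fin k) →
                 (∀ {x y} → x ∈ xs → y ∈ xs → h x ≡ h y → x ≡ y) → length xs ≤ k
Unique⇒length≤ unique h h-inj =
  injective⇒≤ (lookup-injective unique ∘ h-inj (∈-lookup _) (∈-lookup _))

injection⇒≤length : ∀ {A : Set} {xs : List A} {k} (g : Fin k → A) → Injective _≡_ _≡_ g →
                    (∀ i → g i ∈ xs) → k ≤ length xs
injection⇒≤length g g-inj g∈xs =
  injective⇒≤ (g-inj ∘ SetoidMembership.index-injective (setoid _) (g∈xs _) (g∈xs _))

≤-false : ∀ {a} → a ≤ᵇ false → a ≡ false
≤-false b≤b = refl

true-≤ : ∀ {a} → true ≤ᵇ a → a ≡ true
true-≤ b≤b = refl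

∧-≤ˡ : ∀ a b → a ∧ b ≤ᵇ a
∧-≤ˡ false b = b≤b
∧-≤ˡ true  b = ≤-maximum b

∧-≢ʳ : ∀ {a b} → a ∧ b ≢ b → a ≡ false × b ≡ true
∧-≢ʳ {false} {false} neq = ⊥-elim (neq refl)
∧-≢ʳ {false} {true}  _   = refl , refl
∧-≢ʳ {true}  {b}     neq = ⊥-elim (neq refl)

≤-or-inverted : ∀ a b → a ≤ᵇ b ⊎ (a ≡ true × b ≡ false)
≤-or-inverted false b     = inj₁ (≤-minimum b)
≤-or-inverted true  true  = inj₁ b≤b
≤-or-inverted true  false = inj₂ (refl , refl)

≤∧≢⇒rising : ∀ {a b} → a ≤ᵇ b → a ≢ b → a ≡ false × b ≡ true
≤∧≢⇒rising b≤b a≢b = ⊥-elim (a≢b refl)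
≤∧≢⇒rising f≤t _   = refl , refl

Monotone₂ : (Bool → Bool → Bool) → Set
Monotone₂ g = ∀ {a a′ b b′} → a ≤ᵇ a′ → b ≤ᵇ b′ → g a b ≤ᵇ g a′ b′

-- Monotonicity forces b = false and b′ = true, and then pins down all
-- four values of g.
crossing⇒second-projection : ∀ g → Monotone₂ g → ∀ {b b′} →
                             g true b ≡ false → g false b′ ≡ true → ∀ a c → g a c ≡ c
crossing⇒second-projection g mono {true} {b′} g₁b≡0 g₀b′≡1 _ _
  with () ← subst₂ _≤ᵇ_ g₀b′≡1 g₁b≡0 (mono f≤t (≤-maximum b′))
crossing⇒second-projection g mono {false} {false} g₁₀≡0 g₀₀≡1 _ _
  with () ← subst₂ _≤ᵇ_ g₀₀≡1 g₁₀≡0 (mono f≤t b≤b)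
crossing⇒second-projection g mono {false} {true} g₁₀≡0 g₀₁≡1 = projection
  where
  projection : ∀ a c → g a c ≡ c
  projection false false = ≤-false (subst (g false false ≤ᵇ_) g₁₀≡0 (mono f≤t b≤b))
  projection false true  = g₀₁≡1
  projection true  false = g₁₀≡0
  projection true  true  = true-≤ (subst (_≤ᵇ g true true) g₀₁≡1 (mono f≤t b≤b))

-- Monotone Boolean networks

_≤ˢ_ : ∀ {m} → Vec Bool m → Vec Bool m → Set
x ≤ˢ y = ∀ i → x ! i ≤ᵇ y ! i

≤ˢ⇒Pointwise : ∀ {m} {x y : Vec Bool m} → x ≤ˢ y → Pointwise.Pointwise _≤ᵇ_ x y
≤ˢ⇒Pointwise x≤y = Equivalence.to Ext.equivalent (ext x≤y)

monotone-at : ∀ {m} {f : BN m} → Monotone f → ∀ {x y} → x ≤ˢ y → f x ≤ˢ f y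
monotone-at mono x≤y = Pointwise.lookup (mono _ _ (≤ˢ⇒Pointwise x≤y))

vec-ext : ∀ {m} {x y : Vec Bool m} → (∀ i → x ! i ≡ y ! i) → x ≡ y
vec-ext x≗y = Pointwise-≡⇒≡ (ext x≗y)

module Indexing {m} {V : Set} (σ : Fin m ⤖ V) where

  to : Fin m → V
  to = Bijection.to σ

  from : V → Fin m
  from q = proj₁ (Bijection.strictlySurjective σ q)

  to-from : ∀ q → to (from q) ≡ q
  to-from q = proj₂ (Bijection.strictlySurjective σ q)

  from-to : ∀ i → from (to i) ≡ i
  from-to i = Bijection.injective σ (to-from (to i))

  val : Vec Bool m → V → Bool
  val x q = x ! from q

  val-to : ∀ x i → val x (to i) ≡ x ! i
  val-to x i = cong (x !_) (from-to i)

  val-flip-same : ∀ x u → val (x [ u ]%= not) (to u) ≡ not (val x (to u))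
  val-flip-same x u rewrite from-to u = lookup∘updateAt u x

  val-flip-other : ∀ x u {q} → q ≢ to u → val (x [ u ]%= not) q ≡ val x q
  val-flip-other x u {q} q≢ =
    lookup∘updateAt′ (from q) u (λ eq → q≢ (trans (sym (to-from q)) (cong to eq))) x

  val-replicate : ∀ b q → val (replicate m b) q ≡ b
  val-replicate b q = Vec.lookup-replicate (from q) b

module _ {m} (f : BN m) (v : Fin m) where

  -- Walk from x to y flipping one coordinate at a time: the flip that
  -- changes f_v is a dependency of v.
  change-witness : ∀ {x y} → f x ! v ≢ f y ! v → ∃ λ u → DependsOn f u v × x ! u ≢ y ! u
  change-witness {x} {y} = walk (allFin m) x (λ u _ → ∈-allFin u)
    where
    walk : ∀ is x → (∀ u → x ! u ≢ y ! u → u ∈ is) → f x ! v ≢ f y ! v →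
           ∃ λ u → DependsOn f u v × x ! u ≢ y ! u
    walk []       x covered fx≢fy = ⊥-elim (fx≢fy (cong (λ z → f z ! v) (vec-ext {x = x} {y} agree)))
      where
      agree : ∀ u → x ! u ≡ y ! u
      agree u with x ! u ≟ᵇ y ! u
      ... | yes eq = eq
      ... | no neq with covered u neq
      ...   | ()
    walk (i ∷ is) x covered fx≢fy with x ! i ≟ᵇ y ! i
    ... | yes xᵢ≡yᵢ = walk is x covered′ fx≢fy
      where
      covered′ : ∀ u → x ! u ≢ y ! u → u ∈ is
      covered′ u neq with covered u neq
      ... | here refl = ⊥-elim (neq xᵢ≡yᵢ)
      ... | there u∈is = u∈is
    ... | no xᵢ≢yᵢ with f x ! v ≟ᵇ f (x [ i ]%= not) ! v
    ...   | no changes = i , (x , changes) , xᵢ≢yᵢ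
    ...   | yes same with walk is (x [ i ]%= not) covered′ (fx≢fy ∘ trans same)
      where
      covered′ : ∀ u → (x [ i ]%= not) ! u ≢ y ! u → u ∈ is
      covered′ u neq with u ≟ᶠ i
      ... | yes refl = ⊥-elim (neq (trans (lookup∘updateAt i x) (sym (¬-not (xᵢ≢yᵢ ∘ sym)))))
      ... | no u≢i with covered u (neq ∘ trans (lookup∘updateAt′ u i u≢i x))
      ...   | here refl = ⊥-elim (u≢i refl)
      ...   | there u∈is = u∈is
    ...     | u , dep , neq = u , dep , neq ∘ flipped-agrees
      where
      flipped-agrees : x ! u ≡ y ! u → (x [ i ]%= not) ! u ≡ y ! u
      flipped-agrees eq with u ≟ᶠ i
      ... | yes refl = ⊥-elim (xᵢ≢yᵢ eq)
      ... | no u≢i = trans (lookup∘updateAt′ u i u≢i x) eq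

module _ {m} {f : BN m} (mono : Monotone f) {x y : Vec Bool m} (fx≡x : f x ≡ x) (fy≡y : f y ≡ y) where

  -- Compare y with the meet x ∧ y, which lies below x.
  fixed-back : ∀ {v} → x ! v ≡ false → y ! v ≡ true →
               ∃ λ u → DependsOn f u v × x ! u ≡ false × y ! u ≡ true
  fixed-back {v} xᵥ≡0 yᵥ≡1 with change-witness f v {zipWith _∧_ x y} {y} f-meet≢fy
    where
    meet≤x : zipWith _∧_ x y ≤ˢ x
    meet≤x i = subst (_≤ᵇ x ! i) (sym (lookup-zipWith _∧_ i x y)) (∧-≤ˡ (x ! i) (y ! i))
    f-meet≡0 : f (zipWith _∧_ x y) ! v ≡ false
    f-meet≡0 = ≤-false (subst (f (zipWith _∧_ x y) ! v ≤ᵇ_) (trans (cong (_! v) fx≡x) xᵥ≡0)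
                                (monotone-at mono meet≤x v))
    f-meet≢fy : f (zipWith _∧_ x y) ! v ≢ f y ! v
    f-meet≢fy eq with () ← trans (sym f-meet≡0) (trans eq (trans (cong (_! v) fy≡y) yᵥ≡1))
  ... | u , dep , neq = u , dep , ∧-≢ʳ (neq ∘ trans (lookup-zipWith _∧_ u x y))

module _ {m} {f : BN m} (mono : Monotone f) {u w v : Fin m} (u≢w : u ≢ w)
         (inputs : ∀ k → DependsOn f k v → k ≡ u ⊎ k ≡ w) where

  private
    input : Bool → Bool → Vec Bool m
    input a b = (replicate m false [ u ]≔ a) [ w ]≔ b

    input-u : ∀ a b → input a b ! u ≡ a
    input-u a b = trans (lookup∘update′ u≢w (replicate m false [ u ]≔ a) b)
                        (lookup∘update u (replicate m false) a)

    input-w : ∀ a b → input a b ! w ≡ b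
    input-w a b = lookup∘update w (replicate m false [ u ]≔ a) b

    g : Bool → Bool → Bool
    g a b = f (input a b) ! v

    f-via-g : ∀ t → f t ! v ≡ g (t ! u) (t ! w)
    f-via-g t with f t ! v ≟ᵇ g (t ! u) (t ! w)
    ... | yes eq = eq
    ... | no neq with change-witness f v neq
    ...   | k , dep , tₖ≢ with inputs k dep
    ...     | inj₁ refl = ⊥-elim (tₖ≢ (sym (input-u _ _)))
    ...     | inj₂ refl = ⊥-elim (tₖ≢ (sym (input-w _ _)))

    g-monotone : Monotone₂ g
    g-monotone {a} {a′} {b} {b′} a≤a′ b≤b′ = monotone-at mono input≤ v
      where
      input≤ : input a b ≤ˢ input a′ b′
      input≤ k with k ≟ᶠ w | k ≟ᶠ u
      ... | yes refl | _ = subst₂ _≤ᵇ_ (sym (input-w a b)) (sym (input-w a′ b′)) b≤b′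
      ... | no _ | yes refl = subst₂ _≤ᵇ_ (sym (input-u a b)) (sym (input-u a′ b′)) a≤a′
      ... | no k≢w | no k≢u = subst₂ _≤ᵇ_ (sym (elsewhere a b)) (sym (elsewhere a′ b′)) b≤b
        where
        elsewhere : ∀ a b → input a b ! k ≡ false
        elsewhere a b = trans (lookup∘update′ k≢w (replicate m false [ u ]≔ a) b)
                          (trans (lookup∘update′ k≢u (replicate m false) a)
                                 (Vec.lookup-replicate k false))

  -- f_v is a monotone function g of x_u and x_w; the two fixed points
  -- force g to be the projection to x_w, contradicting the dependency on u.
  no-crossing : DependsOn f u v → ∀ {x y} → f x ≡ x → f y ≡ y →
                x ! u ≡ true → x ! v ≡ false → y ! u ≡ false → y ! v ≡ true → ⊥
  no-crossing (t , changes) {x} {y} fx≡x fy≡y xᵤ≡1 xᵥ≡0 yᵤ≡0 yᵥ≡1 = changes (begin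
    f t ! v                            ≡⟨ f-via-g t ⟩
    g (t ! u) (t ! w)                  ≡⟨ g≡π₂ (t ! u) (t ! w) ⟩
    t ! w                              ≡⟨ lookup∘updateAt′ w u (u≢w ∘ sym) t ⟨
    t′ ! w                             ≡⟨ g≡π₂ (t′ ! u) (t′ ! w) ⟨
    g (t′ ! u) (t′ ! w)                ≡⟨ f-via-g t′ ⟨
    f t′ ! v                           ∎)
    where
    open ≡-Reasoning
    t′ = t [ u ]%= not
    value-at-fixed : ∀ {z} → f z ≡ z → g (z ! u) (z ! w) ≡ z ! v
    value-at-fixed {z} fz≡z = trans (sym (f-via-g z)) (cong (_! v) fz≡z)
    g≡π₂ : ∀ a c → g a c ≡ c
    g≡π₂ = crossing⇒second-projection g g-monotone
             (trans (cong (λ a → g a (x ! w)) (sym xᵤ≡1)) (trans (value-at-fixed fx≡x) xᵥ≡0))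
             (trans (cong (λ a → g a (y ! w)) (sym yᵤ≡0)) (trans (value-at-fixed fy≡y) yᵥ≡1))

allStates-complete : ∀ {m} (x : Vec Bool m) → x ∈ allStates m
allStates-complete []ᵛ = here refl
allStates-complete {suc m} (false ∷ᵛ x) = ∈-++⁺ˡ (∈-map⁺ (false ∷ᵛ_) (allStates-complete x))
allStates-complete {suc m} (true  ∷ᵛ x) =
  ∈-++⁺ʳ (map (false ∷ᵛ_) (allStates m)) (∈-map⁺ (true ∷ᵛ_) (allStates-complete x))

allStates-unique : ∀ m → Unique (allStates m)
allStates-unique zero    = All.[] ∷ []
allStates-unique (suc m) =
  Unique.++⁺ (Unique.map⁺ ∷-injectiveʳ (allStates-unique m))
             (Unique.map⁺ ∷-injectiveʳ (allStates-unique m)) heads-differ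
  where
  ∷-injectiveʳ : ∀ {b} {x y : Vec Bool m} → b ∷ᵛ x ≡ b ∷ᵛ y → x ≡ y
  ∷-injectiveʳ refl = refl
  heads-differ : ∀ {x} → ¬ (x ∈ map (false ∷ᵛ_) (allStates m) × x ∈ map (true ∷ᵛ_) (allStates m))
  heads-differ (x∈₀ , x∈₁) with ∈-map⁻ _ x∈₀ | ∈-map⁻ _ x∈₁
  ... | _ , _ , refl | _ , _ , ()

module _ {m} (f : BN m) where

  private
    fixed? = λ x → ≡-decᵛ _≟ᵇ_ (f x) x

  fixCount-≤ : ∀ {k} (h : Vec Bool m → Fin k) →
               (∀ {x y} → f x ≡ x → f y ≡ y → h x ≡ h y → x ≡ y) → fixCount f ≤ k
  fixCount-≤ h h-inj = Unique⇒length≤ (Unique.filter⁺ fixed? (allStates-unique m)) h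
    λ x∈ y∈ → h-inj (fixed-of x∈) (fixed-of y∈)
    where
    fixed-of : ∀ {x} → x ∈ filter fixed? (allStates m) → f x ≡ x
    fixed-of = proj₂ ∘ ∈-filter⁻ fixed? {xs = allStates m}

  ≤-fixCount : ∀ {k} (g : Fin k → Vec Bool m) → Injective _≡_ _≡_ g →
               (∀ i → f (g i) ≡ g i) → k ≤ fixCount f
  ≤-fixCount g g-inj fixed =
    injection⇒≤length g g-inj (λ i → ∈-filter⁺ fixed? (allStates-complete (g i)) (fixed i))

-- Cycles and paths in a digraph

module _ {V : Set} {E : V → V → Set} where

  open Graph E

  Consec⇒∈ : ∀ {a b xs} → Consec a b xs → a ∈ xs × b ∈ xs
  Consec⇒∈ here = here refl , there (here refl)
  Consec⇒∈ (there c) with a∈ , b∈ ← Consec⇒∈ c = there a∈ , there b∈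

  ArcOn⇒∈C : ∀ C {a b} → ArcOn C a b → a ∈C C × b ∈C C
  ArcOn⇒∈C C arc with a∈ , b∈ ← Consec⇒∈ arc = drop-start a∈ , drop-start b∈
    where
    drop-start : ∀ {x} → x ∈ cycVertices C ∷ʳ Cycle.start C → x ∈C C
    drop-start x∈ with ∈-++⁻ (cycVertices C) x∈
    ... | inj₁ x∈C = x∈C
    ... | inj₂ (here refl) = here refl

  private
    Consec-∷ʳ : ∀ {a b xs} z → Consec a b xs → Consec a b (xs ∷ʳ z)
    Consec-∷ʳ z here = here
    Consec-∷ʳ z (there c) = there (Consec-∷ʳ z c)

    Consec-lastOf : ∀ v ws z → Consec (lastOf v ws) z ((v ∷ ws) ∷ʳ z)
    Consec-lastOf v []       z = here
    Consec-lastOf v (w ∷ ws) z = there (Consec-lastOf w ws z)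

    Chain-predecessor : ∀ {a ws v} → Chain a ws → v ∈ ws → ∃ λ w → E w v × Consec w v (a ∷ ws)
    Chain-predecessor (e ∷ _)  (here refl) = _ , e , here
    Chain-predecessor (_ ∷ ch) (there v∈)
      with w , e , c ← Chain-predecessor ch v∈ = w , e , there c

  ∈C⇒predecessor : ∀ C {v} → v ∈C C → ∃ λ w → E w v × ArcOn C w v
  ∈C⇒predecessor record { start = s ; rest = ws ; closing = closing } (here refl) =
    lastOf s ws , closing , Consec-lastOf s ws s
  ∈C⇒predecessor record { start = s ; chain = chain } (there v∈)
    with w , e , c ← Chain-predecessor chain v∈ = w , e , Consec-∷ʳ s c

  last-arc : ∀ (p : Path) → ∃ λ x → E x (Path.end p) × Consec x (Path.end p) (pathVertices p)
                                    × (x ≡ Path.start p ⊎ x ∈ Path.mid p)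
  last-arc record { mid = mid ; end = e ; chain = chain } = go mid chain
    where
    go : ∀ {a} ms → Chain a (ms ∷ʳ e) →
         ∃ λ x → E x e × Consec x e (a ∷ (ms ∷ʳ e)) × (x ≡ a ⊎ x ∈ ms)
    go []       (arc ∷ []) = _ , arc , here , inj₁ refl
    go (m ∷ ms) (_ ∷ chain) with go ms chain
    ... | x , arc , c , inj₁ refl = x , arc , there c , inj₂ (here refl)
    ... | x , arc , c , inj₂ x∈ms = x , arc , there c , inj₂ (there x∈ms)

[m%n+k]%n≡[m+k]%n : ∀ m k n .{{_ : NonZero n}} → (m % n + k) % n ≡ (m + k) % n
[m%n+k]%n≡[m+k]%n m k n = begin
  (m % n + k) % n           ≡⟨ %-distribˡ-+ (m % n) k n ⟩
  (m % n % n + k % n) % n   ≡⟨ cong (λ z → (z + k % n) % n) (m%n%n≡m%n m n) ⟩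
  (m % n + k % n) % n       ≡⟨ %-distribˡ-+ m k n ⟨
  (m + k) % n               ∎
  where open ≡-Reasoning

-- The digraph K*_N

module KStar (n′ : ℕ) where

  N : ℕ
  N = suc n′

  Vertex : Set
  Vertex = Fin N × Fin N

  open Graph (KStarArc N)

  _≟ⱽ_ : DecidableEquality Vertex
  _≟ⱽ_ = ≡-dec _≟ᶠ_ _≟ᶠ_

  next : Fin N → Fin N
  next = sucMod

  toℕ-iterate : ∀ k a → toℕ (iterate next a k) ≡ (toℕ a + k) % N
  toℕ-iterate zero    a = sym (trans (cong (_% N) (+-identityʳ (toℕ a))) (m<n⇒m%n≡m (toℕ<n {N} a)))
  toℕ-iterate (suc k) a = begin
    toℕ (iterate next (next a) k) ≡⟨ toℕ-iterate k (next a) ⟩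
    (toℕ (next a) + k) % N        ≡⟨ cong (λ z → (z + k) % N) (toℕ-fromℕ< (m%n<n (suc (toℕ a)) N)) ⟩
    (suc (toℕ a) % N + k) % N     ≡⟨ [m%n+k]%n≡[m+k]%n (suc (toℕ a)) k N ⟩
    (suc (toℕ a) + k) % N         ≡⟨ cong (_% N) (+-suc (toℕ a) k) ⟨
    (toℕ a + suc k) % N           ∎
    where open ≡-Reasoning

  iterate-N : ∀ a → iterate next a N ≡ a
  iterate-N a = toℕ-injective (begin
    toℕ (iterate next a N) ≡⟨ toℕ-iterate N a ⟩
    (toℕ a + N) % N        ≡⟨ [m+n]%n≡m%n (toℕ a) N ⟩
    toℕ a % N              ≡⟨ m<n⇒m%n≡m (toℕ<n {N} a) ⟩
    toℕ a                  ∎)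
    where open ≡-Reasoning

  iterate-reaches : ∀ a c → ∃ λ k → iterate next a k ≡ c
  iterate-reaches a c = N ∸ toℕ a + toℕ c , toℕ-injective (begin
    toℕ (iterate next a (N ∸ toℕ a + toℕ c)) ≡⟨ toℕ-iterate _ a ⟩
    (toℕ a + (N ∸ toℕ a + toℕ c)) % N        ≡⟨ cong (_% N) (+-assoc (toℕ a) _ _) ⟨
    (toℕ a + (N ∸ toℕ a) + toℕ c) % N        ≡⟨ cong (λ z → (z + toℕ c) % N) a+[N∸a]≡N ⟩
    (N + toℕ c) % N                          ≡⟨ cong (_% N) (+-comm N (toℕ c)) ⟩
    (toℕ c + N) % N                          ≡⟨ [m+n]%n≡m%n (toℕ c) N ⟩
    toℕ c % N                                ≡⟨ m<n⇒m%n≡m (toℕ<n {N} c) ⟩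
    toℕ c                                    ∎)
    where
    open ≡-Reasoning
    a+[N∸a]≡N : toℕ a + (N ∸ toℕ a) ≡ N
    a+[N∸a]≡N = m+[n∸m]≡n (<⇒≤ (toℕ<n {N} a))

  prev : Fin N → Fin N
  prev c = iterate next c n′

  prev-next : ∀ c → prev (next c) ≡ c
  prev-next = iterate-N

  next-prev : ∀ c → next (prev c) ≡ c
  next-prev c = trans (sym (iterate-suc c n′)) (iterate-N c)
    where
    iterate-suc : ∀ a k → iterate next a (suc k) ≡ next (iterate next a k)
    iterate-suc a zero    = refl
    iterate-suc a (suc k) = iterate-suc (next a) k

  step-into : ∀ r c → KStarArc N (r , prev c) (r , c)
  step-into r c = subst (λ z → KStarArc N (r , prev c) (r , z)) (next-prev c) (step r (prev c))

  into-arc : ∀ {w r c} → KStarArc N w (r , c) → w ≡ (r , prev c) ⊎ (w ≡ (c , c) × r ≢ c)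
  into-arc (step i j)     = inj₁ (cong (i ,_) (sym (prev-next j)))
  into-arc (jump i j i≢j) = inj₂ (refl , i≢j ∘ sym)

  BackClosed : (Vertex → Set) → Set
  BackClosed X = ∀ {q} → X q → ∃ λ w → X w × KStarArc N w q

  module _ {X : Vertex → Set} (back : BackClosed X) where

    step-back : ∀ {r c} → X (r , next c) → X (r , c) ⊎ (X (next c , next c) × r ≢ next c)
    step-back x with _ , xw , arc ← back x | into-arc arc
    ... | inj₁ refl          = inj₁ (subst (λ z → X (_ , z)) (prev-next _) xw)
    ... | inj₂ (refl , r≢c) = inj₂ (xw , r≢c)

    back-along-row : ∀ {j} k a → X (j , iterate next a k) → X (j , a) ⊎ ∃ λ i → X (i , i)
    back-along-row zero    a x = inj₁ x
    back-along-row (suc k) a x with back-along-row k (next a) x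
    ... | inj₂ diagonal = inj₂ diagonal
    ... | inj₁ x′ with step-back x′
    ...   | inj₁ x″ = inj₁ x″
    ...   | inj₂ (d , _) = inj₂ (_ , d)

    backClosed⇒diagonal : ∀ {q} → X q → ∃ λ i → X (i , i)
    backClosed⇒diagonal {j , c} x with k , refl ← iterate-reaches j c with back-along-row k j x
    ... | inj₁ d = j , d
    ... | inj₂ d = d

    back-along-column : ∀ k c → (∃ λ r → X (r , iterate next c k)) → ∃ λ r → X (r , c)
    back-along-column zero    c x = x
    back-along-column (suc k) c x with r , x′ ← back-along-column k (next c) x with step-back x′
    ... | inj₁ x″ = r , x″
    ... | inj₂ (d , _) with step-back d
    ...   | inj₁ d′ = next c , d′
    ...   | inj₂ (_ , c≢c) = ⊥-elim (c≢c refl)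

    backClosed⇒column : ∀ {q} → X q → ∀ c → ∃ λ r → X (r , c)
    backClosed⇒column {r , c₀} x c with k , refl ← iterate-reaches c c₀ =
      back-along-column k c (r , x)

  cycle-backClosed : ∀ C → BackClosed (_∈C C)
  cycle-backClosed C v∈C with w , arc , on ← ∈C⇒predecessor C v∈C = w , proj₁ (ArcOn⇒∈C C on) , arc

  cycle-diagonal : ∀ C → ∃ λ i → (i , i) ∈C C
  cycle-diagonal C = backClosed⇒diagonal (cycle-backClosed C) (here refl)

  cycle-column : ∀ C c → ∃ λ r → (r , c) ∈C C
  cycle-column C = backClosed⇒column (cycle-backClosed C) (here refl)

  row : Fin N → Cycle
  row r = record
    { start    = r , zero
    ; rest     = applyUpTo (λ k → r , iterate next zero (suc k)) n′
    ; distinct = Unique.applyUpTo⁺₁ (λ k → r , iterate next zero k) N columns-differ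
    ; chain    = row-chain zero n′
    ; closing  = subst (λ q → KStarArc N q (r , zero)) (sym (row-last zero n′)) (step-into r zero)
    }
    where
    toℕ-column : ∀ {k} → k < N → toℕ (iterate next zero k) ≡ k
    toℕ-column {k} k<N = trans (toℕ-iterate k zero) (m<n⇒m%n≡m k<N)
    columns-differ : ∀ {i j} → i < j → j < N → (r , iterate next zero i) ≢ (r , iterate next zero j)
    columns-differ i<j j<N eq = <⇒≢ i<j (begin
      _ ≡⟨ toℕ-column (<-trans i<j j<N) ⟨
      _ ≡⟨ cong (toℕ ∘ proj₂) eq ⟩
      _ ≡⟨ toℕ-column j<N ⟩
      _ ∎)
      where open ≡-Reasoning
    row-chain : ∀ a l → Chain (r , a) (applyUpTo (λ k → r , iterate next a (suc k)) l)
    row-chain a zero    = []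
    row-chain a (suc l) = step r a ∷ row-chain (next a) l
    row-last : ∀ a l → lastOf (r , a) (applyUpTo (λ k → r , iterate next a (suc k)) l)
                       ≡ (r , iterate next a l)
    row-last a zero    = refl
    row-last a (suc l) = row-last (next a) l

  ∈row : ∀ {r q} → q ∈C row r → proj₁ q ≡ r
  ∈row (here refl) = refl
  ∈row (there q∈) with _ , _ , refl ← ∈-applyUpTo⁻ _ q∈ = refl

  rows : Packing N
  rows = record
    { cyc      = row
    ; disjoint = λ i j i≢j q q∈i q∈j → i≢j (trans (sym (∈row q∈i)) (∈row q∈j))
    }

  packing≤N : ∀ {k} → Packing k → k ≤ N
  packing≤N P = injective⇒≤ {f = diagonal-index} diagonal-index-injective
    where
    open Packing P
    diagonal-index = proj₁ ∘ cycle-diagonal ∘ cyc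
    diagonal-index-injective : ∀ {i j} → diagonal-index i ≡ diagonal-index j → i ≡ j
    diagonal-index-injective {i} {j} eq with i ≟ᶠ j
    ... | yes i≡j = i≡j
    ... | no i≢j = ⊥-elim (disjoint i j i≢j _ (proj₂ (cycle-diagonal (cyc i)))
                     (subst (λ d → (d , d) ∈C cyc j) (sym eq) (proj₂ (cycle-diagonal (cyc j)))))

  diagonal : List Vertex
  diagonal = tabulate (λ i → i , i)

  diagonal-feedback : FeedbackSet diagonal
  diagonal-feedback = Unique.tabulate⁺ {f = λ i → i , i} (cong proj₁) , meets
    where
    meets : ∀ C → ∃ λ v → v ∈ diagonal × v ∈C C
    meets C with i , ii∈C ← cycle-diagonal C = (i , i) , ∈-tabulate⁺ {f = λ i → i , i} i , ii∈C

  feedback≥N : ∀ S → FeedbackSet S → N ≤ length S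
  feedback≥N S (_ , meets) = injection⇒≤length (proj₁ ∘ meets ∘ row) hits-distinct-rows
                               (proj₁ ∘ proj₂ ∘ meets ∘ row)
    where
    hits-distinct-rows : ∀ {r r′} → proj₁ (meets (row r)) ≡ proj₁ (meets (row r′)) → r ≡ r′
    hits-distinct-rows {r} {r′} eq = begin
      r                              ≡⟨ ∈row (proj₂ (proj₂ (meets (row r)))) ⟨
      proj₁ (proj₁ (meets (row r)))  ≡⟨ cong proj₁ eq ⟩
      proj₁ (proj₁ (meets (row r′))) ≡⟨ ∈row (proj₂ (proj₂ (meets (row r′)))) ⟩
      r′                             ∎
      where open ≡-Reasoning

  in-degree≤2 : MaxInDegreeAtMost2
  in-degree≤2 (r , c) us unique arcs = Unique⇒length≤ unique which-arc which-arc-injective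
    where
    which-arc : Vertex → Fin 2
    which-arc w with w ≟ⱽ (r , prev c)
    ... | yes _ = zero
    ... | no  _ = suc zero
    jump-source : ∀ {w} → w ∈ us → w ≢ (r , prev c) → w ≡ (c , c)
    jump-source w∈ w≢ with into-arc (All.lookup arcs w∈)
    ... | inj₁ w≡    = ⊥-elim (w≢ w≡)
    ... | inj₂ (w≡ , _) = w≡
    which-arc-injective : ∀ {w w′} → w ∈ us → w′ ∈ us → which-arc w ≡ which-arc w′ → w ≡ w′
    which-arc-injective {w} {w′} w∈ w′∈ eq with w ≟ⱽ (r , prev c) | w′ ≟ⱽ (r , prev c)
    ... | yes w≡  | yes w′≡  = trans w≡ (sym w′≡)
    ... | no  w≢  | no  w′≢  = trans (jump-source w∈ w≢) (sym (jump-source w′∈ w′≢))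
    which-arc-injective _ _ () | yes _ | no _
    which-arc-injective _ _ () | no _  | yes _

  no-two-independent-cycles : NoTwoIndependentCycles
  no-two-independent-cycles C D (disjoint , no-arcs)
    with c , cc∈C ← cycle-diagonal C
    with r , rc∈D ← cycle-column D c
    with r ≟ᶠ c
  ... | yes refl = disjoint (c , c) cc∈C rc∈D
  ... | no r≢c   = proj₁ (no-arcs (c , c) (r , c) cc∈C rc∈D) (jump c r (r≢c ∘ sym))

  module _ {k} (P : Packing (suc (suc k))) where

    open Packing P

    private
      C₀ C₁ : Cycle
      C₀ = cyc zero
      C₁ = cyc (suc zero)

      0≢1 : _≢_ {A = Fin (suc (suc k))} zero (suc zero)
      0≢1 ()

    module _ {r c} (r≢c : r ≢ c) (rc∈C₀ : (r , c) ∈C C₀) (cc∈C₁ : (c , c) ∈C C₁) where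

      jump-path : Path
      jump-path = record
        { start = c , c ; mid = [] ; end = r , c
        ; chain = jump c r (r≢c ∘ sym) ∷ []
        ; distinctInit = All.[] ∷ [] ; distinctTail = All.[] ∷ []
        }

      jump-principal : Principal P jump-path
      jump-principal = All.[] , arc-off-packing
        where
        arc-off-packing : ∀ a b → Consec a b (pathVertices jump-path) → ∀ i → ¬ ArcOn (cyc i) a b
        arc-off-packing _ _ here i on with i ≟ᶠ suc zero | ArcOn⇒∈C (cyc i) on
        ... | yes refl | _ , rc∈C₁   = disjoint zero (suc zero) 0≢1 (r , c) rc∈C₀ rc∈C₁
        ... | no i≢1   | cc∈Cᵢ , _   = disjoint i (suc zero) i≢1 (c , c) cc∈Cᵢ cc∈C₁
        arc-off-packing _ _ (there (there ()))

      -- C₀ enters (r , c) along an arc, which cannot come from (c , c) ∈ C₁.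
      row-arc-on-C₀ : ArcOn C₀ (r , prev c) (r , c)
      row-arc-on-C₀ with w , w→rc , on ← ∈C⇒predecessor C₀ rc∈C₀ with into-arc w→rc
      ... | inj₁ refl       = on
      ... | inj₂ (refl , _) =
        ⊥-elim (disjoint zero (suc zero) 0≢1 (c , c) (proj₁ (ArcOn⇒∈C C₀ on)) cc∈C₁)

      no-principal-path-from-C₀ : ¬ PrincipalFromCycleTo P zero (r , c)
      no-principal-path-from-C₀ (p , (mid-off , arcs-off) , start∈C₀ , refl)
        with x , arc , x→rc , x-position ← last-arc p
        with into-arc arc | x-position
      ... | inj₁ refl       | _           = arcs-off _ _ x→rc zero row-arc-on-C₀
      ... | inj₂ (refl , _) | inj₁ refl   = disjoint zero (suc zero) 0≢1 (c , c) start∈C₀ cc∈C₁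
      ... | inj₂ (refl , _) | inj₂ x∈mid = All.lookup mid-off x∈mid (suc zero) cc∈C₁

    two-cycles-not-special : ¬ Special P
    two-cycles-not-special special
      with c , cc∈C₁ ← cycle-diagonal C₁
      with r , rc∈C₀ ← cycle-column C₀ c
      with r ≟ᶠ c
    ... | yes refl = disjoint zero (suc zero) 0≢1 (c , c) rc∈C₀ cc∈C₁
    ... | no r≢c
      with special zero (r , c) rc∈C₀
             (suc zero , 0≢1 ∘ sym , jump-path r≢c rc∈C₀ cc∈C₁ ,
              jump-principal r≢c rc∈C₀ cc∈C₁ , cc∈C₁ , refl)
    ...   | inj₁ from-C₀ = no-principal-path-from-C₀ r≢c rc∈C₀ cc∈C₁ from-C₀
    ...   | inj₂ (p , _ , source , _) = source _ (step-into _ _)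

  special-packing≤1 : ∀ k (P : Packing k) → Special P → k ≤ 1
  special-packing≤1 zero          _ _       = z≤n
  special-packing≤1 (suc zero)    _ _       = s≤s z≤n
  special-packing≤1 (suc (suc k)) P special = ⊥-elim (two-cycles-not-special P special)

  single-row : Σ (Packing 1) Special
  single-row = packing , λ { zero _ _ (zero , 0≢0 , _) → ⊥-elim (0≢0 refl) }
    where
    packing : Packing 1
    packing = record { cyc = λ _ → row zero ; disjoint = λ { zero zero 0≢0 → ⊥-elim (0≢0 refl) } }

  module FixedPointBound {m} {f : BN m} (mono : Monotone f)
                         (iso : InteractionGraphIso f (KStarArc N)) where

    open Indexing (proj₁ iso)

    private
      dep⇒arc : ∀ {u v} → DependsOn f u v → KStarArc N (to u) (to v)
      dep⇒arc = Equivalence.to (proj₂ iso _ _)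

      arc⇒dep : ∀ {u v} → KStarArc N (to u) (to v) → DependsOn f u v
      arc⇒dep = Equivalence.from (proj₂ iso _ _)

    Rising : Vec Bool m → Vec Bool m → Vertex → Set
    Rising x y q = val x q ≡ false × val y q ≡ true

    rising-at : ∀ x y i → x ! i ≡ false → y ! i ≡ true → Rising x y (to i)
    rising-at x y i xᵢ≡0 yᵢ≡1 = trans (val-to x i) xᵢ≡0 , trans (val-to y i) yᵢ≡1

    rising-backClosed : ∀ {x y} → f x ≡ x → f y ≡ y → BackClosed (Rising x y)
    rising-backClosed {x} {y} fx≡x fy≡y {q} (x≡0 , y≡1)
      with u , dep , xᵤ≡0 , yᵤ≡1 ← fixed-back mono fx≡x fy≡y x≡0 y≡1 =
      to u , rising-at x y u xᵤ≡0 yᵤ≡1 , subst (KStarArc N (to u)) (to-from q) (dep⇒arc dep)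

    no-crossing-on-jump : ∀ {x y r c} → f x ≡ x → f y ≡ y → r ≢ c →
                          Rising y x (c , c) → Rising x y (r , c) → ⊥
    no-crossing-on-jump {x} {y} {r} {c} fx≡x fy≡y r≢c (y≡0 , x≡1) (x≡0 , y≡1) =
      no-crossing mono u≢w inputs (arc⇒dep jump-arc) fx≡x fy≡y x≡1 x≡0 y≡0 y≡1
      where
      u = from (c , c)
      w = from (r , prev c)
      v = from (r , c)
      u≢w : u ≢ w
      u≢w eq = r≢c (sym (cong proj₁ (trans (sym (to-from _)) (trans (cong to eq) (to-from _)))))
      inputs : ∀ k → DependsOn f k v → k ≡ u ⊎ k ≡ w
      inputs k dep with into-arc (subst (KStarArc N (to k)) (to-from _) (dep⇒arc dep))
      ... | inj₁ eq       = inj₂ (trans (sym (from-to k)) (cong from eq))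
      ... | inj₂ (eq , _) = inj₁ (trans (sym (from-to k)) (cong from eq))
      jump-arc : KStarArc N (to u) (to v)
      jump-arc = subst₂ (KStarArc N) (sym (to-from _)) (sym (to-from _)) (jump c r (r≢c ∘ sym))

    -- Both sets of rising vertices are back-closed, so the first reaches
    -- the diagonal at some (c , c) and the second reaches column c.
    fixed-no-crossing : ∀ {x y q q′} → f x ≡ x → f y ≡ y → Rising y x q → Rising x y q′ → ⊥
    fixed-no-crossing fx≡x fy≡y yx xy
      with c , yx′ ← backClosed⇒diagonal (rising-backClosed fy≡y fx≡x) yx
      with r , xy′ ← backClosed⇒column (rising-backClosed fx≡x fy≡y) xy c
      with r ≟ᶠ c
    ... | yes refl with () ← trans (sym (proj₂ yx′)) (proj₁ xy′)
    ... | no r≢c   = no-crossing-on-jump fx≡x fy≡y r≢c yx′ xy′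

    fixed-comparable : ∀ {x y} → f x ≡ x → f y ≡ y → x ≤ˢ y ⊎ y ≤ˢ x
    fixed-comparable {x} {y} fx≡x fy≡y with any? (λ i → y ! i ≟ᵇ false ×-dec x ! i ≟ᵇ true)
    ... | no no-fall = inj₁ (λ i → below i)
      where
      below : ∀ i → x ! i ≤ᵇ y ! i
      below i with ≤-or-inverted (x ! i) (y ! i)
      ... | inj₁ x≤y           = x≤y
      ... | inj₂ (x≡1 , y≡0) = ⊥-elim (no-fall (i , y≡0 , x≡1))
    ... | yes (i , yᵢ≡0 , xᵢ≡1) = inj₂ above
      where
      above : ∀ j → y ! j ≤ᵇ x ! j
      above j with ≤-or-inverted (y ! j) (x ! j)
      ... | inj₁ y≤x           = y≤x
      ... | inj₂ (y≡1 , x≡0) =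
        ⊥-elim (fixed-no-crossing fx≡x fy≡y (rising-at y x i yᵢ≡0 xᵢ≡1) (rising-at x y j x≡0 y≡1))

    diagonal-set : Vec Bool m → Subset N
    diagonal-set x = tabulateᵛ (λ c → val x (c , c))

    ∈-diagonal-set⁻ : ∀ x {c} → c ∈ˢ diagonal-set x → val x (c , c) ≡ true
    ∈-diagonal-set⁻ x {c} c∈ = trans (sym (lookup∘tabulate (λ c → val x (c , c)) c)) ([]=⇒lookup c∈)

    ∈-diagonal-set⁺ : ∀ x {c} → val x (c , c) ≡ true → c ∈ˢ diagonal-set x
    ∈-diagonal-set⁺ x {c} x≡1 = lookup⇒[]= c _ (trans (lookup∘tabulate (λ c → val x (c , c)) c) x≡1)

    ≤ˢ⇒diagonal-⊆ : ∀ {x y} → x ≤ˢ y → diagonal-set x ⊆ diagonal-set y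
    ≤ˢ⇒diagonal-⊆ {x} {y} x≤y {c} c∈ =
      ∈-diagonal-set⁺ y
        (true-≤ (subst (_≤ᵇ val y (c , c)) (∈-diagonal-set⁻ x c∈) (x≤y (from (c , c)))))

    -- A rise between comparable fixed points propagates back to the diagonal.
    fixed-≤-diagonal-injective : ∀ {x y} → f x ≡ x → f y ≡ y → x ≤ˢ y →
                                 ∣ diagonal-set x ∣ ≡ ∣ diagonal-set y ∣ → x ≡ y
    fixed-≤-diagonal-injective {x} {y} fx≡x fy≡y x≤y same-size = vec-ext {x = x} {y} agree
      where
      agree : ∀ i → x ! i ≡ y ! i
      agree i with x ! i ≟ᵇ y ! i
      ... | yes eq = eq
      ... | no neq
        with xᵢ≡0 , yᵢ≡1 ← ≤∧≢⇒rising (x≤y i) neq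
        with c , (x≡0 , y≡1) ← backClosed⇒diagonal (rising-backClosed fx≡x fy≡y)
                                                  (rising-at x y i xᵢ≡0 yᵢ≡1)
        = ⊥-elim (<⇒≢ (p⊂q⇒∣p∣<∣q∣ diagonal-⊂) same-size)
        where
        diagonal-⊂ : diagonal-set x ⊂ diagonal-set y
        diagonal-⊂ = ≤ˢ⇒diagonal-⊆ {x} {y} x≤y , c , ∈-diagonal-set⁺ y y≡1 ,
                     λ c∈ → case trans (sym (∈-diagonal-set⁻ x c∈)) x≡0 of λ ()

    fixed-diagonal-injective : ∀ {x y} → f x ≡ x → f y ≡ y →
                               ∣ diagonal-set x ∣ ≡ ∣ diagonal-set y ∣ → x ≡ y
    fixed-diagonal-injective fx≡x fy≡y same-size with fixed-comparable fx≡x fy≡y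
    ... | inj₁ x≤y = fixed-≤-diagonal-injective fx≡x fy≡y x≤y same-size
    ... | inj₂ y≤x = sym (fixed-≤-diagonal-injective fy≡y fx≡x y≤x (sym same-size))

    fixCount≤1+N : fixCount f ≤ suc N
    fixCount≤1+N = fixCount-≤ f diagonal-size λ {x} {y} fx≡x fy≡y eq →
      fixed-diagonal-injective fx≡x fy≡y (toℕ-diagonal-size-injective {x} {y} eq)
      where
      diagonal-size : Vec Bool m → Fin (suc N)
      diagonal-size x = fromℕ< (s≤s (∣p∣≤n (diagonal-set x)))
      toℕ-diagonal-size-injective : ∀ {x y} → diagonal-size x ≡ diagonal-size y →
                                    ∣ diagonal-set x ∣ ≡ ∣ diagonal-set y ∣
      toℕ-diagonal-size-injective eq = trans (sym (toℕ-fromℕ< _)) (trans (cong toℕ eq) (toℕ-fromℕ< _))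

  module Construction where

    m : ℕ
    m = N * N

    -- Opaque, so that unification never unfolds the index arithmetic of *↔×.
    opaque
      indexing : Fin m ⤖ Vertex
      indexing = ↔⇒⤖ *↔×

    open Indexing indexing

    rule : Fin N → Fin N → Bool → Bool → Bool
    rule r c a b with <-cmp c r
    ... | tri< _ _ _ = a ∧ b
    ... | tri≈ _ _ _ = a
    ... | tri> _ _ _ = a ∨ b

    localRule : (Vertex → Bool) → Vertex → Bool
    localRule s (r , c) = rule r c (s (r , prev c)) (s (c , c))

    network : BN m
    network x = tabulateᵛ (localRule (val x) ∘ to)

    network-! : ∀ x i → network x ! i ≡ localRule (val x) (to i)
    network-! x = lookup∘tabulate (localRule (val x) ∘ to)

    rule-diagonal : ∀ r a b → rule r r a b ≡ a
    rule-diagonal r a b with <-cmp r r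
    ... | tri< r<r _ _ = ⊥-elim (<-irrefl refl r<r)
    ... | tri≈ _ _ _   = refl
    ... | tri> _ _ r<r = ⊥-elim (<-irrefl refl r<r)

    rule-monotone : ∀ r c → Monotone₂ (rule r c)
    rule-monotone r c a≤a′ b≤b′ with <-cmp c r
    ... | tri< _ _ _ = ∧-monotone a≤a′ b≤b′
      where
      ∧-monotone : Monotone₂ _∧_
      ∧-monotone {false} b≤b _    = b≤b
      ∧-monotone {true}  b≤b b≤b′ = b≤b′
      ∧-monotone f≤t _            = ≤-minimum _
    ... | tri≈ _ _ _ = a≤a′
    ... | tri> _ _ _ = ∨-monotone a≤a′ b≤b′
      where
      ∨-monotone : Monotone₂ _∨_
      ∨-monotone {false} b≤b b≤b′ = b≤b′
      ∨-monotone {true}  b≤b _    = b≤b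
      ∨-monotone f≤t _            = ≤-maximum _

    network-monotone : Monotone network
    network-monotone x y x≤y = ≤ˢ⇒Pointwise λ i →
      subst₂ _≤ᵇ_ (sym (network-! x i)) (sym (network-! y i)) (localRule-monotone (to i))
      where
      localRule-monotone : ∀ q → localRule (val x) q ≤ᵇ localRule (val y) q
      localRule-monotone (r , c) =
        rule-monotone r c (Pointwise.lookup x≤y (from (r , prev c))) (Pointwise.lookup x≤y (from (c , c)))

    localRule-changes⇒arc : ∀ {s s′ : Vertex → Bool} {a} q → (∀ p → p ≢ a → s p ≡ s′ p) →
                            localRule s q ≢ localRule s′ q → KStarArc N a q
    localRule-changes⇒arc {a = a} (r , c) agree changes with a ≟ⱽ (r , prev c)
    ... | yes refl = step-into r c
    ... | no a≢row with r ≟ᶠ c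
    ...   | yes refl = ⊥-elim (changes (trans (rule-diagonal r _ _)
                          (trans (agree _ (a≢row ∘ sym)) (sym (rule-diagonal r _ _)))))
    ...   | no r≢c with a ≟ⱽ (c , c)
    ...     | yes refl = jump c r (r≢c ∘ sym)
    ...     | no a≢cc  =
      ⊥-elim (changes (cong₂ (rule r c) (agree _ (a≢row ∘ sym)) (agree _ (a≢cc ∘ sym))))

    network-dep⇒arc : ∀ {u v} → DependsOn network u v → KStarArc N (to u) (to v)
    network-dep⇒arc {u} {v} (t , changes) =
      localRule-changes⇒arc (to v) (λ p p≢ → sym (val-flip-other t u p≢))
        (λ eq → changes (trans (network-! t v) (trans eq (sym (network-! (t [ u ]%= not) v)))))

    -- In the constant state base r c (the unit of ∧ resp. ∨), flipping
    -- either input of (r , c) changes its value.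
    base : Fin N → Fin N → Bool
    base r c with <-cmp c r
    ... | tri< _ _ _ = true
    ... | tri≈ _ _ _ = true
    ... | tri> _ _ _ = false

    rule-sensitive : ∀ r c → r ≢ c →
                     rule r c (not (base r c)) (base r c) ≢ rule r c (base r c) (base r c)
                     × rule r c (base r c) (not (base r c)) ≢ rule r c (base r c) (base r c)
    rule-sensitive r c r≢c with <-cmp c r
    ... | tri< _ _ _   = (λ ()) , (λ ())
    ... | tri≈ _ c≡r _ = ⊥-elim (r≢c (sym c≡r))
    ... | tri> _ _ _   = (λ ()) , (λ ())

    arc⇒sensitive : ∀ {a r c} → KStarArc N a (r , c) → ∀ s →
                    s a ≡ not (base r c) → (∀ p → p ≢ a → s p ≡ base r c) →
                    localRule s (r , c) ≢ rule r c (base r c) (base r c)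
    arc⇒sensitive {r = r} {c} arc s s-flipped s-elsewhere with into-arc arc
    ... | inj₁ refl with r ≟ᶠ c
    ...   | yes refl = λ eq → not-¬ refl (trans (sym (rule-diagonal r _ _)) (trans (sym eq)
                         (trans (rule-diagonal r _ _) s-flipped)))
    ...   | no r≢c = λ eq → proj₁ (rule-sensitive r c r≢c) (trans
                       (cong₂ (rule r c) (sym s-flipped) (sym (s-elsewhere (c , c) (r≢c ∘ sym ∘ cong proj₁))))
                       eq)
    arc⇒sensitive {r = r} {c} arc s s-flipped s-elsewhere | inj₂ (refl , r≢c) = λ eq →
      proj₂ (rule-sensitive r c r≢c)
        (trans (cong₂ (rule r c) (sym (s-elsewhere (r , prev c) (r≢c ∘ cong proj₁))) (sym s-flipped)) eq)

    arc⇒network-dep : ∀ {u v} → KStarArc N (to u) (to v) → DependsOn network u v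
    arc⇒network-dep {u} {v} arc = constant , λ eq →
      arc⇒sensitive arc (val flipped)
        (trans (val-flip-same constant u) (cong not (val-replicate β (to u))))
        (λ p p≢ → trans (val-flip-other constant u p≢) (val-replicate β p))
        (begin
          localRule (val flipped) (to v) ≡⟨ network-! flipped v ⟨
          network flipped ! v            ≡⟨ eq ⟨
          network constant ! v           ≡⟨ network-! constant v ⟩
          localRule (val constant) (to v) ≡⟨ cong₂ (rule r c) (val-replicate β _) (val-replicate β _) ⟩
          rule r c β β                   ∎)
      where
      open ≡-Reasoning
      r = proj₁ (to v)
      c = proj₂ (to v)
      β = base r c
      constant = replicate m β
      flipped = constant [ u ]%= not

    network-interaction : InteractionGraphIso network (KStarArc N)
    network-interaction = indexing , λ u v → mk⇔ network-dep⇒arc arc⇒network-dep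

    below : ℕ → Fin N → Bool
    below k r with toℕ r <? k
    ... | yes _ = true
    ... | no  _ = false

    rule-below : ∀ k r c → rule r c (below k r) (below k c) ≡ below k r
    rule-below k r c with <-cmp c r | toℕ r <? k | toℕ c <? k
    ... | tri< _ _ _   | no _    | _       = refl
    ... | tri< _ _ _   | yes _   | yes _   = refl
    ... | tri< c<r _ _ | yes r<k | no c≮k  = ⊥-elim (c≮k (<-trans c<r r<k))
    ... | tri≈ _ _ _   | _       | _       = refl
    ... | tri> _ _ _   | yes _   | _       = refl
    ... | tri> _ _ _   | no _    | no _    = refl
    ... | tri> _ _ r<c | no r≮k  | yes c<k = ⊥-elim (r≮k (<-trans r<c c<k))

    threshold : ℕ → Vec Bool m
    threshold k = tabulateᵛ (below k ∘ proj₁ ∘ to)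

    val-threshold : ∀ k q → val (threshold k) q ≡ below k (proj₁ q)
    val-threshold k q =
      trans (lookup∘tabulate (below k ∘ proj₁ ∘ to) (from q)) (cong (below k ∘ proj₁) (to-from q))

    threshold-fixed : ∀ k → network (threshold k) ≡ threshold k
    threshold-fixed k = vec-ext {x = network (threshold k)} {threshold k} fixed-at
      where
      fixed-at : ∀ i → network (threshold k) ! i ≡ threshold k ! i
      fixed-at i = begin
        network (threshold k) ! i              ≡⟨ network-! (threshold k) i ⟩
        localRule (val (threshold k)) (r , c)  ≡⟨ cong₂ (rule r c) (val-threshold k _) (val-threshold k _) ⟩
        rule r c (below k r) (below k c)       ≡⟨ rule-below k r c ⟩
        below k r                              ≡⟨ lookup∘tabulate (below k ∘ proj₁ ∘ to) i ⟨
        threshold k ! i                        ∎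
        where
        open ≡-Reasoning
        r = proj₁ (to i)
        c = proj₂ (to i)

    threshold-<-distinct : ∀ {k l} → k < l → l ≤ N → threshold k ≢ threshold l
    threshold-<-distinct {k} {l} k<l l≤N eq = below-differs (begin
        below k r                    ≡⟨ val-threshold k (r , zero) ⟨
        val (threshold k) (r , zero) ≡⟨ cong (λ x → val x (r , zero)) eq ⟩
        val (threshold l) (r , zero) ≡⟨ val-threshold l (r , zero) ⟩
        below l r                    ∎)
      where
      open ≡-Reasoning
      r = fromℕ< (<-≤-trans k<l l≤N)
      toℕ-r : toℕ r ≡ k
      toℕ-r = toℕ-fromℕ< _
      below-differs : below k r ≢ below l r
      below-differs with toℕ r <? k | toℕ r <? l
      ... | yes r<k | _      = ⊥-elim (<-irrefl toℕ-r r<k)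
      ... | no _    | yes _  = λ ()
      ... | no _    | no r≮l = ⊥-elim (r≮l (subst (_< l) (sym toℕ-r) k<l))

    threshold-injective : Injective _≡_ _≡_ (threshold ∘ toℕ {suc N})
    threshold-injective {k} {l} eq with <-cmp k l
    ... | tri< k<l _ _ = ⊥-elim (threshold-<-distinct k<l (toℕ≤pred[n] l) eq)
    ... | tri≈ _ k≡l _ = k≡l
    ... | tri> _ _ l<k = ⊥-elim (threshold-<-distinct l<k (toℕ≤pred[n] k) (sym eq))

    1+N≤fixCount : suc N ≤ fixCount network
    1+N≤fixCount = ≤-fixCount network (threshold ∘ toℕ) threshold-injective (threshold-fixed ∘ toℕ)

  φₘ≡1+N : PhiMIs (KStarArc N) (suc N)
  φₘ≡1+N = (m , network , network-monotone , network-interaction ,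
             ≤-antisym (FixedPointBound.fixCount≤1+N network-monotone network-interaction) 1+N≤fixCount)
         , λ _ _ mono iso → FixedPointBound.fixCount≤1+N mono iso
    where open Construction

proposition2 : ∀ (n : ℕ) .{{_ : NonZero n}} →
    Graph.NuIs (KStarArc n) n
    × Graph.TauIs (KStarArc n) n
    × Graph.NuStarIs (KStarArc n) 1
    × Graph.MaxInDegreeAtMost2 (KStarArc n)
    × Graph.NoTwoIndependentCycles (KStarArc n)
    × PhiMIs (KStarArc n) (suc n)
proposition2 (suc n′) =
  (rows , λ _ → packing≤N) ,
  ((diagonal , diagonal-feedback , length-tabulate (λ i → i , i)) , feedback≥N) ,
  (single-row , special-packing≤1) ,
  in-degree≤2 ,
  no-two-independent-cycles ,
  φₘ≡1+N
  where open KStar n′
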